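{- Let $\Gamma, x: B \vdash M: C$ and $\Gamma \vdash N : B$ be type assignments derivable in $\mathsf{ND}_{\mathsf{CK}}$. Then $\Gamma ,x:B\vdash M\{N/x\} : C$ is derivable in $\mathsf{ND}_{\mathsf{CK}}$.
   Context: Types are generated by $A ::= a \mid (A\to A) \mid \Box A$, with $a$ ranging over a countable set of atoms. Modal $\lambda$-terms are generated from a countable set of variables by $M,N ::= x \mid \lambda x.M \mid MN \mid M[N_1,\ldots,N_n/x_1,\ldots,x_n]$, where in the last constructor (explicit substitution) $x_1,\ldots,x_n$ are distinct variables bound in $M$; terms are considered modulo $\alpha$-equivalence (Barendregt convention) and modulo simultaneous permutation of the pairs $N_i/x_i$. Free variables: $FV(x)=\{x\}$, $FV(\lambda x.N)=FV(N)\setminus\{x\}$, $FV(NP)=FV(N)\cup FV(P)$, $FV(N[P_1,\ldots,P_n/x_1,\ldots,x_n])=\bigcup_i FV(P_i)$. $M\{N/x\}$ denotes the capture-avoiding (meta-level) substitution of $N$ for the free occurrences of $x$ in $M$. A context $\Gamma$ is a finite list of declarations $x:A$ with pairwise distinct variables ($\Gamma,y:B$ presupposes $y$ does not appear in $\Gamma$). The system $\mathsf{ND}_{\mathsf{CK}}$ has the rules: (Id) $x_1:A_1,\ldots,x_n:A_n\vdash x_i:A_i$; (Abs) from $\Gamma,x:A\vdash M:C$ infer $\Gamma\vdash \lambda x.M:A\to C$; (App) from $\Gamma\vdash N:A$ and $\Gamma\vdash M:A\to C$ infer $\Gamma\vdash MN:C$; ($\Box$-subst) from $\Gamma\vdash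 N_i:\Box A_i$ for all $i\in\{1,\ldots,n\}$ and $x_1:A_1,\ldots,x_n:A_n\vdash M:C$ infer $\Gamma\vdash M[N_1,\ldots,N_n/x_1,\ldots,x_n]:\Box C$, provided $x_1,\ldots,x_n$ do not occur in $\Gamma$. A type assignment is derivable if it is the root of a finite tree built with these rules whose leaves are instances of (Id). -}

module Defs where

open import Data.Nat using (ℕ; zero; suc)
open import Data.Fin using (Fin; zero; suc)
open import Data.Vec using (Vec; []; _∷_; lookup)

data Ty : Set where
  atom : ℕ → Ty
  _⇒_  : Ty → Ty → Ty
  □_   : Ty → Ty

infixr 7 _⇒_
infix 8 □_

-- Tm n : terms whose free variables are among n variables.
-- box M Ns  represents  M[N₁,…,Nₖ/x₁,…,xₖ] : M has (at most) the k bound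
-- variables x₁…xₖ free, and FV(M[Ns/xs]) = ⋃ FV(Nᵢ).
data Tm (n : ℕ) : Set where
  var : Fin n → Tm n
  lam : Tm (suc n) → Tm n
  app : Tm n → Tm n → Tm n
  box : ∀ {k} → Tm k → Vec (Tm n) k → Tm n

ext : ∀ {m n} → (Fin m → Fin n) → Fin (suc m) → Fin (suc n)
ext ρ zero    = zero
ext ρ (suc i) = suc (ρ i)

mutual
  ren : ∀ {m n} → (Fin m → Fin n) → Tm m → Tm n
  ren ρ (var i)    = var (ρ i)
  ren ρ (lam M)    = lam (ren (ext ρ) M)
  ren ρ (app M N)  = app (ren ρ M) (ren ρ N)
  ren ρ (box M Ns) = box M (renVec ρ Ns)

  renVec : ∀ {m n k} → (Fin m → Fin n) → Vec (Tm m) k → Vec (Tm n) k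
  renVec ρ []       = []
  renVec ρ (N ∷ Ns) = ren ρ N ∷ renVec ρ Ns

-- Capture-avoiding (meta-level) simultaneous substitution.
-- Under an explicit substitution only the Nᵢ are affected
-- (the variables of M are bound).
exts : ∀ {m n} → (Fin m → Tm n) → Fin (suc m) → Tm (suc n)
exts σ zero    = var zero
exts σ (suc i) = ren suc (σ i)

mutual
  sub : ∀ {m n} → (Fin m → Tm n) → Tm m → Tm n
  sub σ (var i)    = σ i
  sub σ (lam M)    = lam (sub (exts σ) M)
  sub σ (app M N)  = app (sub σ M) (sub σ N)
  sub σ (box M Ns) = box M (subVec σ Ns)

  subVec : ∀ {m n k} → (Fin m → Tm n) → Vec (Tm m) k → Vec (Tm n) k
  subVec σ []       = []
  subVec σ (N ∷ Ns) = sub σ N ∷ subVec σ Ns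

-- Contexts: Ctx n lists the types of the n variables; index zero is the
-- most recently added variable, so  (B ∷ Γ)  is  "Γ, x:B"  with x = var zero.
Ctx : ℕ → Set
Ctx n = Vec Ty n

-- M{N/x} for M in context Γ,x (x = var zero) and N in context Γ,
-- the result again read in context Γ,x (x simply no longer occurs).
_[_/x] : ∀ {n} → Tm (suc n) → Tm n → Tm (suc n)
M [ N /x] = sub σ M
  where
  σ : Fin (suc _) → Tm (suc _)
  σ zero    = ren suc N
  σ (suc i) = var (suc i)

infix 4 _⊢_∶_
data _⊢_∶_ {n : ℕ} (Γ : Ctx n) : Tm n → Ty → Set where
  Id     : ∀ i → Γ ⊢ var i ∶ lookup Γ i
  Abs    : ∀ {A C M} → (A ∷ Γ) ⊢ M ∶ C → Γ ⊢ lam M ∶ A ⇒ C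
  App    : ∀ {A C M N} → Γ ⊢ N ∶ A → Γ ⊢ M ∶ A ⇒ C → Γ ⊢ app M N ∶ C
  □-subst : ∀ {k} {As : Vec Ty k} {C} {M : Tm k} {Ns : Vec (Tm n) k}
          → (∀ i → Γ ⊢ lookup Ns i ∶ □ (lookup As i))
          → As ⊢ M ∶ C
          → Γ ⊢ box M Ns ∶ □ C

{-# OPTIONS --safe #-}
module Submission where

-- Typing is preserved by well-typed renamings (hence by weakening) and then by
-- well-typed simultaneous substitutions, which must be pushed under binders via
-- weakening. The □-subst case needs no induction on the body: substitution only
-- acts on the explicit substitutes Nᵢ, whose typings are in the outer context.

open import Data.Nat using (suc)
open import Data.Fin using (Fin; zero; suc)
open import Data.Vec using (Vec; _∷_; lookup)
open import Relation.Binary.PropositionalEquality using (_≡_; refl; sym; subst)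
open import Defs

lookup-renVec : ∀ {m n k} (ρ : Fin m → Fin n) (Ns : Vec (Tm m) k) (i : Fin k)
  → lookup (renVec ρ Ns) i ≡ ren ρ (lookup Ns i)
lookup-renVec ρ (N ∷ Ns) zero    = refl
lookup-renVec ρ (N ∷ Ns) (suc i) = lookup-renVec ρ Ns i

lookup-subVec : ∀ {m n k} (σ : Fin m → Tm n) (Ns : Vec (Tm m) k) (i : Fin k)
  → lookup (subVec σ Ns) i ≡ sub σ (lookup Ns i)
lookup-subVec σ (N ∷ Ns) zero    = refl
lookup-subVec σ (N ∷ Ns) (suc i) = lookup-subVec σ Ns i

infix 4 _⊢ʳ_∶_ _⊢ˢ_∶_

_⊢ʳ_∶_ : ∀ {m n} → Ctx n → (Fin m → Fin n) → Ctx m → Set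
Δ ⊢ʳ ρ ∶ Γ = ∀ i → lookup Δ (ρ i) ≡ lookup Γ i

_⊢ˢ_∶_ : ∀ {m n} → Ctx n → (Fin m → Tm n) → Ctx m → Set
Δ ⊢ˢ σ ∶ Γ = ∀ i → Δ ⊢ σ i ∶ lookup Γ i

ext-⊢ʳ : ∀ {m n} {Γ : Ctx m} {Δ : Ctx n} {ρ} (A : Ty)
  → Δ ⊢ʳ ρ ∶ Γ → A ∷ Δ ⊢ʳ ext ρ ∶ A ∷ Γ
ext-⊢ʳ A ⊢ρ zero    = refl
ext-⊢ʳ A ⊢ρ (suc i) = ⊢ρ i

⊢-ren : ∀ {m n} {Γ : Ctx m} {Δ : Ctx n} {ρ M C}
  → Δ ⊢ʳ ρ ∶ Γ → Γ ⊢ M ∶ C → Δ ⊢ ren ρ M ∶ C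
⊢-ren {Δ = Δ} {ρ} ⊢ρ (Id i) = subst (Δ ⊢ var (ρ i) ∶_) (⊢ρ i) (Id (ρ i))
⊢-ren ⊢ρ (Abs {A} ⊢M)       = Abs (⊢-ren (ext-⊢ʳ A ⊢ρ) ⊢M)
⊢-ren ⊢ρ (App ⊢N ⊢M)        = App (⊢-ren ⊢ρ ⊢N) (⊢-ren ⊢ρ ⊢M)
⊢-ren {Δ = Δ} {ρ} ⊢ρ (□-subst {As = As} {Ns = Ns} ⊢Ns ⊢M) = □-subst ⊢renNs ⊢M
  where
  ⊢renNs : ∀ i → Δ ⊢ lookup (renVec ρ Ns) i ∶ □ lookup As i
  ⊢renNs i = subst (Δ ⊢_∶ □ lookup As i) (sym (lookup-renVec ρ Ns i)) (⊢-ren ⊢ρ (⊢Ns i))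

⊢-weaken : ∀ {n} {Γ : Ctx n} {M A} (B : Ty) → Γ ⊢ M ∶ A → B ∷ Γ ⊢ ren suc M ∶ A
⊢-weaken B = ⊢-ren (λ _ → refl)

exts-⊢ˢ : ∀ {m n} {Γ : Ctx m} {Δ : Ctx n} {σ} (A : Ty)
  → Δ ⊢ˢ σ ∶ Γ → A ∷ Δ ⊢ˢ exts σ ∶ A ∷ Γ
exts-⊢ˢ A ⊢σ zero    = Id zero
exts-⊢ˢ A ⊢σ (suc i) = ⊢-weaken A (⊢σ i)

⊢-sub : ∀ {m n} {Γ : Ctx m} {Δ : Ctx n} {σ M C}
  → Δ ⊢ˢ σ ∶ Γ → Γ ⊢ M ∶ C → Δ ⊢ sub σ M ∶ C
⊢-sub ⊢σ (Id i)        = ⊢σ i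
⊢-sub ⊢σ (Abs {A} ⊢M)  = Abs (⊢-sub (exts-⊢ˢ A ⊢σ) ⊢M)
⊢-sub ⊢σ (App ⊢N ⊢M)   = App (⊢-sub ⊢σ ⊢N) (⊢-sub ⊢σ ⊢M)
⊢-sub {Δ = Δ} {σ} ⊢σ (□-subst {As = As} {Ns = Ns} ⊢Ns ⊢M) = □-subst ⊢subNs ⊢M
  where
  ⊢subNs : ∀ i → Δ ⊢ lookup (subVec σ Ns) i ∶ □ lookup As i
  ⊢subNs i = subst (Δ ⊢_∶ □ lookup As i) (sym (lookup-subVec σ Ns i)) (⊢-sub ⊢σ (⊢Ns i))

lemma3p5 : ∀ {n} (Γ : Ctx n) (B C : Ty) (M : Tm (suc n)) (N : Tm n)
    → (B ∷ Γ) ⊢ M ∶ C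
    → Γ ⊢ N ∶ B
    → (B ∷ Γ) ⊢ M [ N /x] ∶ C
lemma3p5 Γ B C M N ⊢M ⊢N = ⊢-sub (λ { zero → ⊢-weaken B ⊢N ; (suc i) → Id (suc i) }) ⊢M
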